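{- The deterministic and the nondeterministic $\mathsf{LimInf}$-automata over infinite words are closed under sum, with cost $O(n_1\cdot n_2\cdot 2^{m_1\cdot m_2})$.
   Context: A weighted automaton is $A=(Q,q_I,\Sigma,\delta,\gamma)$ with finite state set $Q$, initial state $q_I$, finite alphabet $\Sigma$, total transition relation $\delta\subseteq Q\times\Sigma\times Q$, and weights $\gamma:\delta\to\mathbb{Q}$; deterministic if for all $q,\sigma$ exactly one $q'$ with $(q,\sigma,q')\in\delta$. A run over $w=\sigma_1\sigma_2\dots\in\Sigma^\omega$ is $q_0\sigma_1q_1\dots$ with $q_0=q_I$, $(q_i,\sigma_{i+1},q_{i+1})\in\delta$, weight sequence $v_i=\gamma(q_i,\sigma_{i+1},q_{i+1})$. A $\mathsf{LimInf}$-automaton defines $L_A(w)=\sup$ over runs on $w$ of $\liminf_nv_n$. $(L_1+L_2)(w)=L_1(w)+L_2(w)$. A class $\mathcal{C}$ is closed under sum with cost at most $O(f(n_1,m_1,n_2,m_2))$ if for all $A_1,A_2\in\mathcal{C}$, with $A_i$ having $n_i$ states and $m_i$ transitions, one can construct $A_{12}\in\mathcal{C}$ with $L_{A_{12}}=L_{A_1}+L_{A_2}$ and $O(f(n_1,m_1,n_2,m_2))$ states. -}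

module Defs where

open import Data.Nat as ℕ using (ℕ; zero; suc)
open import Data.Fin using (Fin)
open import Data.Bool using (Bool; true; false; if_then_else_)
open import Data.List using (List; map; allFin)
open import Data.Nat.ListAction using (sum)
open import Data.Unit using (⊤)
open import Data.Product using (Σ; ∃; ∃-syntax; _×_; _,_)
open import Data.Rational using (ℚ; _+_; _-_; _<_; _≤_; 0ℚ)
open import Relation.Binary.PropositionalEquality using (_≡_)

-- The transition relation δ ⊆ Q × Σ × Q is given by its characteristic
-- function; the weight function γ is given on all triples, but only its
-- values on triples in δ are ever used.
record WA (k : ℕ) : Set where
  field
    n     : ℕ
    qI    : Fin n
    δ     : Fin n → Fin k → Fin n → Bool
    γ     : Fin n → Fin k → Fin n → ℚ
    total : ∀ q σ → ∃[ q' ] (δ q σ q' ≡ true)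
open WA public

states : ∀ {k} → WA k → ℕ
states A = n A

transitions : ∀ {k} → WA k → ℕ
transitions {k} A =
  sum (map (λ q → sum (map (λ σ → sum (map (λ q' →
      if δ A q σ q' then 1 else 0) (allFin (n A)))) (allFin k))) (allFin (n A)))

Deterministic : ∀ {k} → WA k → Set
Deterministic A = ∀ q σ q₁ q₂ → δ A q σ q₁ ≡ true → δ A q σ q₂ ≡ true → q₁ ≡ q₂

Word : ℕ → Set
Word k = ℕ → Fin k

record Run {k} (A : WA k) (w : Word k) : Set where
  field
    ρ     : ℕ → Fin (n A)
    init  : ρ 0 ≡ qI A
    valid : ∀ i → δ A (ρ i) (w i) (ρ (suc i)) ≡ true
open Run public

weights : ∀ {k} {A : WA k} {w : Word k} → Run A w → ℕ → ℚ
weights {A = A} {w} r i = γ A (ρ r i) (w i) (ρ r (suc i))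

IsLimInf : (ℕ → ℚ) → ℚ → Set
IsLimInf v x =
  ∀ (ε : ℚ) → 0ℚ < ε →
    (∃[ N ] ∀ j → N ℕ.≤ j → x - ε < v j) ×
    (∀ N → ∃[ j ] (N ℕ.≤ j × v j < x + ε))

IsSup : (ℚ → Set) → ℚ → Set
IsSup S x = (∀ y → S y → y ≤ x) × (∀ b → (∀ y → S y → y ≤ b) → x ≤ b)

LimInfValue : ∀ {k} → WA k → Word k → ℚ → Set
LimInfValue A w x = IsSup (λ y → Σ (Run A w) λ r → IsLimInf (weights r) y) x

IsSumOf : ∀ {k} → WA k → WA k → WA k → Set
IsSumOf {k} A₁₂ A₁ A₂ = ∀ (w : Word k) (x₁ x₂ : ℚ) →
  LimInfValue A₁ w x₁ → LimInfValue A₂ w x₂ → LimInfValue A₁₂ w (x₁ + x₂)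

ClosedUnderSumCost : (∀ {k} → WA k → Set) → Set
ClosedUnderSumCost P =
  ∃[ c ] ∀ {k} (A₁ A₂ : WA k) → P A₁ → P A₂ →
    Σ (WA k) λ A₁₂ → P A₁₂ × IsSumOf A₁₂ A₁ A₂ ×
      states A₁₂ ℕ.≤ c ℕ.* (states A₁ ℕ.* states A₂ ℕ.* 2 ℕ.^ (transitions A₁ ℕ.* transitions A₂))

AnyWA : ∀ {k} → WA k → Set
AnyWA _ = ⊤

module Submission where

-- Name the transitions of Aᵢ by Fin mᵢ.  The sum automaton runs A₁ and A₂
-- in parallel and keeps a Boolean m₁ × m₂ memory whose bit (i', j') says that A₁ took
-- transition i' since A₂ last took transition j'.  When A₁ takes i and A₂ takes j, the
-- product transition gets the weight  min { γ₁ i' | i' = i or bit (i', j) } + γ₂ j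
-- (the window minimum), and the memory clears column j and records i in all other
-- columns.  States are coded in Fin (n₁ · n₂ · 2^(m₁ · m₂)); the product of two
-- deterministic automata is deterministic.
--
-- Run weights take finitely many values, so liminfs are attained
-- (ExactLimInf).  For two label sequences with weight sequences u, v and window weights z,
-- liminf z = liminf u + liminf v, reasoning classically in the double-negation monad:
-- liminf-combined proves "≥, with equality infinitely often" (stale memory bits of light
-- labels are eventually cleared), liminf-split proves "≤" via the minimal weights of the
-- recurring labels and a pigeonhole argument on the low values of z.  Runs of the sum
-- automaton project to pairs of runs (Projection) and pairs of runs lift to runs
-- (Lifting), so the supremum of the run values is x₁ + x₂ (sup-sum).

open import Defs
open import Data.Nat as ℕ using (ℕ; zero; suc)
import Data.Nat.Properties as ℕₚ
open import Data.Fin using (Fin; zero; suc; toℕ; combine; remQuot; funToFin; finToFun)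
import Data.Fin.Properties as Finₚ
open import Data.Fin.Properties using (_≟_)
open import Data.Bool using (Bool; true; false; _∨_; _∧_; if_then_else_)
open import Data.Bool.Properties using (∨-zeroʳ)
open import Data.Maybe using (Maybe; just; nothing)
open import Data.Maybe.Properties using (just-injective)
open import Data.List using (List; []; _∷_; length; lookup; map; allFin; concatMap)
open import Data.List.Properties using (length-++; map-cong)
open import Data.List.Relation.Unary.Any using (here; index; any?)
open import Data.List.Relation.Unary.Any.Properties using (lookup-index)
open import Data.List.Membership.Propositional using (_∈_; lose)
open import Data.List.Membership.Propositional.Properties using (∈-concatMap⁺; ∈-allFin)
open import Data.Nat.ListAction using (sum)
open import Data.Product using (Σ; ∃-syntax; _×_; _,_; proj₁; proj₂)
open import Data.Product.Properties using (≡-dec)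
open import Data.Sum using (_⊎_; inj₁; inj₂)
open import Data.Empty using (⊥; ⊥-elim)
open import Data.Unit using (tt)
open import Data.Rational using (ℚ; _+_; _-_; _<_; _≤_; 0ℚ; 1ℚ; -_; _⊓_)
open import Data.Rational.Properties
  using ( +-monoˡ-≤; +-monoʳ-≤; +-monoˡ-<; +-monoʳ-<; +-mono-≤; +-mono-<-≤; +-mono-≤-<
        ; neg-antimono-<; neg-antimono-≤; +-identityʳ; +-inverseʳ; +-comm
        ; ≤-reflexive; ≤-trans; <-trans; ≤-<-trans; <-≤-trans; <-irrefl; <-cmp; ≮⇒≥; ≰⇒>; _≤?_
        ; positive⁻¹; ⊓-sel; p⊓q≤p; p⊓q≤q; ⊓-glb )
open import Function using (_∘_)
open import Function.Bundles using (Inverse)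
open import Level using (0ℓ)
open import Effect.Monad using (RawMonad)
open import Relation.Nullary using (¬_; Dec; yes; no; does)
open import Relation.Nullary.Decidable using (dec-true; dec-false; decidable-stable; ¬¬-excluded-middle)
open import Relation.Nullary.Negation using (¬¬-Monad; DoubleNegation; contradiction)
open import Relation.Binary using (DecidableEquality; tri<; tri≈; tri>)
open import Relation.Binary.PropositionalEquality
open import Data.Rational.Solver using (module +-*-Solver)

-- Classical case distinctions are made inside the double-negation monad; all final
-- conclusions are rational inequalities, which are decidable and hence ¬¬-stable.
open RawMonad (¬¬-Monad {0ℓ}) using (pure; _>>=_)

a+[b-a]≡b : ∀ a b → a + (b - a) ≡ b
a+[b-a]≡b = solve 2 (λ a b → a :+ (b :- a) := b) refl
  where open +-*-Solver

[a+c]-a≡c : ∀ a c → (a + c) - a ≡ c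
[a+c]-a≡c = solve 2 (λ a c → (a :+ c) :- a := c) refl
  where open +-*-Solver

a-[a-b]≡b : ∀ a b → a - (a - b) ≡ b
a-[a-b]≡b = solve 2 (λ a b → a :- (a :- b) := b) refl
  where open +-*-Solver

≤-sub⁺ : ∀ {a b c} → a + c ≤ b → c ≤ b - a
≤-sub⁺ {a} {b} {c} a+c≤b = subst (_≤ b - a) ([a+c]-a≡c a c) (+-monoˡ-≤ (- a) a+c≤b)

≤-sub⁻ : ∀ {a b c} → c ≤ b - a → a + c ≤ b
≤-sub⁻ {a} {b} {c} c≤b-a = subst (a + c ≤_) (a+[b-a]≡b a b) (+-monoʳ-≤ a c≤b-a)

sup-sum : ∀ {S₁ S₂ x₁ x₂ b} → IsSup S₁ x₁ → IsSup S₂ x₂ → (∀ y₁ y₂ → S₁ y₁ → S₂ y₂ → y₁ + y₂ ≤ b) → x₁ + x₂ ≤ b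
sup-sum {x₁ = x₁} {x₂} {b} (_ , least₁) (_ , least₂) bounded =
  subst (_≤ b) (+-comm x₂ x₁) (≤-sub⁻ (least₁ (b - x₂) λ y₁ s₁ →
    ≤-sub⁺ (subst (_≤ b) (+-comm y₁ x₂) (≤-sub⁻ (least₂ (b - y₁) λ y₂ s₂ → ≤-sub⁺ (bounded y₁ y₂ s₁ s₂))))))

+-≤-split : ∀ {a b x y} → a ≤ x → b ≤ y → x + y ≤ a + b → x ≤ a × y ≤ b
+-≤-split a≤x b≤y sum≤ =
  ≮⇒≥ (λ a<x → <-irrefl refl (<-≤-trans (+-mono-<-≤ a<x b≤y) sum≤)) ,
  ≮⇒≥ (λ b<y → <-irrefl refl (<-≤-trans (+-mono-≤-< a≤x b<y) sum≤))

centre-above : ∀ y {ε} → 0ℚ < ε → y - ε < y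
centre-above y {ε} 0<ε = subst (y - ε <_) (+-identityʳ y) (+-monoʳ-< y (neg-antimono-< 0<ε))

centre-below : ∀ y {ε} → 0ℚ < ε → y < y + ε
centre-below y {ε} 0<ε = subst (_< y + ε) (+-identityʳ y) (+-monoʳ-< y 0<ε)

difference-positive : ∀ {a b} → a < b → 0ℚ < b - a
difference-positive {a} {b} a<b = subst (_< b - a) (+-inverseʳ a) (+-monoˡ-< (- a) a<b)

Isolated : ℚ → ℚ → ℚ → Set
Isolated y ε a = y - ε < a → a < y + ε → a ≡ y

isolated-mono : ∀ {y ε ε' a} → ε' ≤ ε → Isolated y ε a → Isolated y ε' a
isolated-mono {y} ε'≤ε iso lo hi =
  iso (≤-<-trans (+-monoʳ-≤ y (neg-antimono-≤ ε'≤ε)) lo) (<-≤-trans hi (+-monoʳ-≤ y ε'≤ε))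

isolate : ∀ y a → ∃[ ε ] (0ℚ < ε × Isolated y ε a)
isolate y a with <-cmp a y
... | tri< a<y _ _ = y - a , difference-positive a<y , λ lo _ → ⊥-elim (<-irrefl (a-[a-b]≡b y a) lo)
... | tri≈ _ a≡y _ = 1ℚ , positive⁻¹ 1ℚ , λ _ _ → a≡y
... | tri> _ _ y<a = a - y , difference-positive y<a , λ _ hi → ⊥-elim (<-irrefl (sym (a+[b-a]≡b y a)) hi)

min-positive : ∀ {a b} → 0ℚ < a → 0ℚ < b → 0ℚ < a ⊓ b
min-positive {a} {b} 0<a 0<b with ⊓-sel a b
... | inj₁ e = subst (0ℚ <_) (sym e) 0<a
... | inj₂ e = subst (0ℚ <_) (sym e) 0<b

common-radius : ∀ m (P : Fin m → ℚ → Set) → (∀ i {ε ε'} → ε' ≤ ε → P i ε → P i ε') →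
                (∀ i → ∃[ ε ] (0ℚ < ε × P i ε)) → ∃[ ε ] (0ℚ < ε × ∀ i → P i ε)
common-radius zero P mono h = 1ℚ , positive⁻¹ 1ℚ , λ ()
common-radius (suc m) P mono h
  with h zero | common-radius m (λ i → P (suc i)) (λ i → mono (suc i)) (λ i → h (suc i))
... | ε₀ , 0<ε₀ , P₀ | ε₁ , 0<ε₁ , P₁ = ε₀ ⊓ ε₁ , min-positive 0<ε₀ 0<ε₁ , λ where
  zero    → mono zero (p⊓q≤p ε₀ ε₁) P₀
  (suc i) → mono (suc i) (p⊓q≤q ε₀ ε₁) (P₁ i)

isolate-finite : ∀ {a b c} (f : Fin a → Fin b → Fin c → ℚ) y →
                 ∃[ ε ] (0ℚ < ε × ∀ x x' x'' → Isolated y ε (f x x' x''))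
isolate-finite {a} {b} {c} f y =
  common-radius a (λ x ε → ∀ x' x'' → Isolated y ε (f x x' x''))
    (λ x ε'≤ε iso x' x'' → isolated-mono ε'≤ε (iso x' x''))
    λ x → common-radius b (λ x' ε → ∀ x'' → Isolated y ε (f x x' x''))
      (λ x' ε'≤ε iso x'' → isolated-mono ε'≤ε (iso x''))
      λ x' → common-radius c (λ x'' ε → Isolated y ε (f x x' x''))
        (λ x'' → isolated-mono) (λ x'' → isolate y (f x x' x''))

Eventually : (ℕ → Set) → Set
Eventually P = ∃[ N ] ∀ t → N ℕ.≤ t → P t

InfinitelyOften : (ℕ → Set) → Set
InfinitelyOften P = ∀ N → ∃[ t ] (N ℕ.≤ t × P t)

-- For sequences with finitely many values this is equivalent to IsLimInf, and it is the
-- form in which the combinatorial arguments below are carried out.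
ExactLimInf : (ℕ → ℚ) → ℚ → Set
ExactLimInf f y = Eventually (λ t → y ≤ f t) × InfinitelyOften (λ t → f t ≤ y)

exact⇒liminf : ∀ {f y} → ExactLimInf f y → IsLimInf f y
exact⇒liminf {f} {y} ((N , above) , below) ε 0<ε =
  (N , λ t N≤t → <-≤-trans (centre-above y 0<ε) (above t N≤t)) ,
  λ M → let (t , M≤t , ft≤y) = below M in t , M≤t , ≤-<-trans ft≤y (centre-below y 0<ε)

liminf⇒exact : ∀ {f y ε} → 0ℚ < ε → (∀ t → Isolated y ε (f t)) → IsLimInf f y → ExactLimInf f y
liminf⇒exact {f} {y} {ε} 0<ε iso L = (N , above) , below
  where
  N = proj₁ (proj₁ (L ε 0<ε))
  above : ∀ t → N ℕ.≤ t → y ≤ f t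
  above t N≤t = ≮⇒≥ λ ft<y →
    let lo = proj₂ (proj₁ (L ε 0<ε)) t N≤t
    in <-irrefl (iso t lo (<-trans ft<y (centre-below y 0<ε))) ft<y
  below : ∀ M → ∃[ t ] (M ℕ.≤ t × f t ≤ y)
  below M = let (t , M≤t , hi) = proj₂ (L ε 0<ε) M in
    t , M≤t , ≮⇒≥ λ y<ft → <-irrefl (sym (iso t (<-trans (centre-above y 0<ε) y<ft) hi)) y<ft

exact-cong : ∀ {f g y} → (∀ t → f t ≡ g t) → ExactLimInf f y → ExactLimInf g y
exact-cong {y = y} f≗g ((N , above) , below) =
  (N , λ t N≤t → subst (y ≤_) (f≗g t) (above t N≤t)) ,
  λ M → let (t , M≤t , ft≤y) = below M in t , M≤t , subst (_≤ y) (f≗g t) ft≤y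

-- The weights of a run take finitely many values, so its liminf is attained.
run-exact : ∀ {k} {A : WA k} {w : Word k} (r : Run A w) {y} → IsLimInf (weights r) y → ExactLimInf (weights r) y
run-exact {A = A} {w} r {y} L =
  let (ε , 0<ε , isolated) = isolate-finite (γ A) y
  in liminf⇒exact 0<ε (λ t → isolated (ρ r t) (w t) (ρ r (suc t))) L

¬¬-all-Fin : ∀ m {P : Fin m → Set} → (∀ i → DoubleNegation (P i)) → DoubleNegation (∀ i → P i)
¬¬-all-Fin zero h = pure λ ()
¬¬-all-Fin (suc m) h = do
  p₀ ← h zero
  pₛ ← ¬¬-all-Fin m (λ i → h (suc i))
  pure λ where
    zero    → p₀
    (suc i) → pₛ i

¬¬-decide-Fin : ∀ m (P : Fin m → Set) → DoubleNegation (∀ i → Dec (P i))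
¬¬-decide-Fin m P = ¬¬-all-Fin m (λ i → ¬¬-excluded-middle)

eventually-all : ∀ m {P : Fin m → ℕ → Set} → (∀ i → Eventually (P i)) → Eventually (λ t → ∀ i → P i t)
eventually-all zero h = 0 , λ _ _ ()
eventually-all (suc m) {P} h with h zero | eventually-all m (λ i → h (suc i))
... | N₀ , P₀ | Nₛ , Pₛ = N₀ ℕ.⊔ Nₛ , λ where
  t le zero    → P₀ t (ℕₚ.m⊔n≤o⇒m≤o N₀ Nₛ le)
  t le (suc i) → Pₛ t (ℕₚ.m⊔n≤o⇒n≤o N₀ Nₛ le) i

module Witnesses {P : ℕ → Set} (often : InfinitelyOften P) (N : ℕ) where
  witness : ℕ → ℕ
  witness zero    = proj₁ (often N)
  witness (suc k) = proj₁ (often (suc (witness k)))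

  witness-holds : ∀ k → P (witness k)
  witness-holds zero    = proj₂ (proj₂ (often N))
  witness-holds (suc k) = proj₂ (proj₂ (often (suc (witness k))))

  witness-step : ∀ k → witness k ℕ.< witness (suc k)
  witness-step k = proj₁ (proj₂ (often (suc (witness k))))

  witness-increasing : ∀ {k l} → k ℕ.< l → witness k ℕ.< witness l
  witness-increasing k<l = go (ℕₚ.≤⇒≤‴ k<l)
    where
    go : ∀ {k l} → suc k ℕ.≤‴ l → witness k ℕ.< witness l
    go {k} ℕ.≤‴-refl        = witness-step k
    go {k} (ℕ.≤‴-step sk<l) = ℕₚ.<-trans (witness-step k) (go sk<l)

  witness-late : ∀ k → N ℕ.≤ witness k
  witness-late zero    = proj₁ (proj₂ (often N))
  witness-late (suc k) = ℕₚ.≤-trans (witness-late k) (ℕₚ.<⇒≤ (witness-step k))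

minOver : ∀ m → (Fin m → Bool) → (Fin m → ℚ) → ℚ → ℚ
minOver zero    c f d = d
minOver (suc m) c f d with c zero
... | true  = f zero ⊓ minOver m (λ i → c (suc i)) (λ i → f (suc i)) d
... | false = minOver m (λ i → c (suc i)) (λ i → f (suc i)) d

minOver-≤ : ∀ m c f d i → c i ≡ true → minOver m c f d ≤ f i
minOver-≤ (suc m) c f d zero ci with c zero
... | true = p⊓q≤p _ _
minOver-≤ (suc m) c f d (suc i) ci with c zero
... | true  = ≤-trans (p⊓q≤q (f zero) _) (minOver-≤ m (λ i → c (suc i)) (λ i → f (suc i)) d i ci)
... | false = minOver-≤ m (λ i → c (suc i)) (λ i → f (suc i)) d i ci

minOver-glb : ∀ m c f d a → a ≤ d → (∀ i → c i ≡ true → a ≤ f i) → a ≤ minOver m c f d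
minOver-glb zero    c f d a a≤d h = a≤d
minOver-glb (suc m) c f d a a≤d h with c zero in c₀
... | true  = ⊓-glb (h zero c₀) (minOver-glb m _ _ d a a≤d (λ i → h (suc i)))
... | false = minOver-glb m _ _ d a a≤d (λ i → h (suc i))

minOver-attained : ∀ m c f d → minOver m c f d ≡ d ⊎ ∃[ i ] (c i ≡ true × minOver m c f d ≡ f i)
minOver-attained zero c f d = inj₁ refl
minOver-attained (suc m) c f d with c zero in c₀
... | false with minOver-attained m (λ i → c (suc i)) (λ i → f (suc i)) d
...   | inj₁ e              = inj₁ e
...   | inj₂ (i , ci , e)   = inj₂ (suc i , ci , e)
minOver-attained (suc m) c f d | true
  with ⊓-sel (f zero) (minOver m (λ i → c (suc i)) (λ i → f (suc i)) d)
...   | inj₁ e = inj₂ (zero , c₀ , e)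
...   | inj₂ e with minOver-attained m (λ i → c (suc i)) (λ i → f (suc i)) d
...     | inj₁ e'            = inj₁ (trans e e')
...     | inj₂ (i , ci , e') = inj₂ (suc i , ci , trans e e')

minOver-cong : ∀ m c c' f d → (∀ i → c i ≡ c' i) → minOver m c f d ≡ minOver m c' f d
minOver-cong zero    c c' f d c≗c' = refl
minOver-cong (suc m) c c' f d c≗c'
  with c zero | c' zero | c≗c' zero
     | minOver-cong m (λ i → c (suc i)) (λ i → c' (suc i)) (λ i → f (suc i)) d (λ i → c≗c' (suc i))
... | true  | true  | refl | rest = cong (f zero ⊓_) rest
... | false | false | refl | rest = rest

repetition : ∀ m (g : ℕ → Fin m) → ∃[ k ] ∃[ l ] (k ℕ.< l × g k ≡ g l)
repetition m g =
  let (k , l , k<l , e) = Finₚ.pigeonhole (ℕₚ.n<1+n m) (λ i → g (toℕ i)) in toℕ k , toℕ l , k<l , e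

_==_ : ∀ {m} → Fin m → Fin m → Bool
i == j = does (i ≟ j)

==-refl : ∀ {m} (i : Fin m) → (i == i) ≡ true
==-refl i = dec-true (i ≟ i) refl

==⇒≡ : ∀ {m} {i j : Fin m} → (i == j) ≡ true → i ≡ j
==⇒≡ {i = i} {j} e with i ≟ j
... | yes i≡j = i≡j

≢⇒==false : ∀ {m} {i j : Fin m} → ¬ i ≡ j → (i == j) ≡ false
≢⇒==false {i = i} {j} = dec-false (i ≟ j)

true≢false : true ≡ false → ⊥
true≢false ()

∧-true : ∀ {a b} → (a ∧ b) ≡ true → a ≡ true × b ≡ true
∧-true {true} {true} _ = refl , refl

∨-true : ∀ {a b} → (a ∨ b) ≡ true → a ≡ true ⊎ b ≡ true
∨-true {true}  _ = inj₁ refl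
∨-true {false} e = inj₂ e

∨-introʳ : ∀ a {b} → b ≡ true → (a ∨ b) ≡ true
∨-introʳ a refl = ∨-zeroʳ a

if-false-else : ∀ {c x} → (if c then false else x) ≡ true → c ≡ false × x ≡ true
if-false-else {false} e = refl , e

Vanishes : ∀ {m} → (ℕ → Fin m) → Fin m → Set
Vanishes lab i = Eventually (λ t → ¬ lab t ≡ i)

module RecurrentMinimum {m} (wt : Fin m → ℚ) (lab : ℕ → Fin m) (vanishes? : ∀ i → Dec (Vanishes lab i)) where
  recurring : Fin m → Bool
  recurring i with vanishes? i
  ... | yes _ = false
  ... | no  _ = true

  recurring-often : ∀ i → recurring i ≡ true → ∀ K → DoubleNegation (∃[ t ] (K ℕ.≤ t × lab t ≡ i))
  recurring-often i r K with vanishes? i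
  ... | no never-vanishes = λ ¬occurs → never-vanishes (K , λ t K≤t e → ¬occurs (t , K≤t , e))

  eventually-recurring : Eventually (λ t → recurring (lab t) ≡ true)
  eventually-recurring =
    let (N , h) = eventually-all m vanishing-bound
    in N , λ t N≤t → h t N≤t (lab t) refl
    where
    vanishing-bound : ∀ i → Eventually (λ t → lab t ≡ i → recurring i ≡ true)
    vanishing-bound i with vanishes? i
    ... | yes (M , gone) = M , λ t M≤t e → contradiction e (gone t M≤t)
    ... | no _           = 0 , λ _ _ _ → refl

  bound : ℕ
  bound = proj₁ eventually-recurring

  α : ℚ
  α = minOver m recurring wt (wt (lab bound))

  α-below : ∀ t → bound ℕ.≤ t → α ≤ wt (lab t)
  α-below t le = minOver-≤ m recurring wt _ (lab t) (proj₂ eventually-recurring t le)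

  α-attained : ∃[ i ] (recurring i ≡ true × α ≡ wt i)
  α-attained with minOver-attained m recurring wt (wt (lab bound))
  ... | inj₁ e = lab bound , proj₂ eventually-recurring bound ℕₚ.≤-refl , e
  ... | inj₂ r = r

-- Two label sequences are read in
-- parallel; a memory bit (i', j') records whether the first sequence has read i' since
-- the second sequence last read j'.
module WindowMinimum {m₁ m₂ : ℕ} (wt₁ : Fin m₁ → ℚ) (wt₂ : Fin m₂ → ℚ) where

  Memory : Set
  Memory = Fin m₁ → Fin m₂ → Bool

  remember : Memory → Fin m₁ → Fin m₂ → Memory
  remember B i j i' j' = if j' == j then false else (B i' j' ∨ i' == i)

  remember-cong : ∀ B B' i j → (∀ i' j' → B i' j' ≡ B' i' j') →
                  ∀ i' j' → remember B i j i' j' ≡ remember B' i j i' j'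
  remember-cong B B' i j B≗B' i' j' = cong (λ b → if j' == j then false else (b ∨ (i' == i))) (B≗B' i' j')

  window : Memory → Fin m₁ → Fin m₂ → Fin m₁ → Bool
  window B i j i' = B i' j ∨ i' == i

  combined : Memory → Fin m₁ → Fin m₂ → ℚ
  combined B i j = minOver m₁ (window B i j) wt₁ (wt₁ i) + wt₂ j

  combined-cong : ∀ B B' i j → (∀ i' j' → B i' j' ≡ B' i' j') → combined B i j ≡ combined B' i j
  combined-cong B B' i j B≗B' =
    cong (_+ wt₂ j) (minOver-cong m₁ _ _ wt₁ (wt₁ i) (λ i' → cong (_∨ (i' == i)) (B≗B' i' j)))

  combined-≤ : ∀ B i j i' → window B i j i' ≡ true → combined B i j ≤ wt₁ i' + wt₂ j
  combined-≤ B i j i' inw = +-monoˡ-≤ (wt₂ j) (minOver-≤ m₁ _ wt₁ _ i' inw)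

  combined-attained : ∀ B i j → ∃[ i' ] (window B i j i' ≡ true × combined B i j ≡ wt₁ i' + wt₂ j)
  combined-attained B i j with minOver-attained m₁ (window B i j) wt₁ (wt₁ i)
  ... | inj₁ e            = i , ∨-introʳ (B i j) (==-refl i) , cong (_+ wt₂ j) e
  ... | inj₂ (i' , w , e) = i' , w , cong (_+ wt₂ j) e

  record Trace : Set where
    field
      lab₁     : ℕ → Fin m₁
      lab₂     : ℕ → Fin m₂
      mem      : ℕ → Memory
      mem-step : ∀ t i' j' → mem (suc t) i' j' ≡ remember (mem t) (lab₁ t) (lab₂ t) i' j'

  module Along (T : Trace) where
    open Trace T public

    u v z : ℕ → ℚ
    u t = wt₁ (lab₁ t)
    v t = wt₂ (lab₂ t)
    z t = combined (mem t) (lab₁ t) (lab₂ t)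

    InWindow : ℕ → Fin m₂ → Fin m₁ → Set
    InWindow t j' i' = window (mem t) (lab₁ t) j' i' ≡ true

    Pending : ℕ → Fin m₁ → Fin m₂ → Set
    Pending t i' j' = mem t i' j' ≡ true ⊎ lab₁ t ≡ i'

    pending⇒window : ∀ {t i' j'} → Pending t i' j' → InWindow t j' i'
    pending⇒window {t} {i'} {j'} (inj₁ b) = subst (λ x → (x ∨ (i' == lab₁ t)) ≡ true) (sym b) refl
    pending⇒window {t} (inj₂ refl) = ∨-introʳ _ (==-refl (lab₁ t))

    pending-persists : ∀ {t i' j'} → ¬ lab₂ t ≡ j' → Pending t i' j' → mem (suc t) i' j' ≡ true
    pending-persists {t} {i'} {j'} j'≢ p = begin
      mem (suc t) i' j'                                                   ≡⟨ mem-step t i' j' ⟩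
      (if j' == lab₂ t then false else window (mem t) (lab₁ t) j' i')     ≡⟨ cong (λ c → if c then false else _) (≢⇒==false (j'≢ ∘ sym)) ⟩
      window (mem t) (lab₁ t) j' i'                                       ≡⟨ pending⇒window p ⟩
      true                                                                ∎
      where open ≡-Reasoning

    pending-seen : ∀ {t t' i' j'} → t ℕ.≤ t' → lab₂ t' ≡ j' → Pending t i' j' →
                   ∃[ s ] (t ℕ.≤ s × lab₂ s ≡ j' × InWindow s j' i')
    pending-seen t≤t' = go (ℕₚ.≤⇒≤‴ t≤t')
      where
      go : ∀ {t t' i' j'} → t ℕ.≤‴ t' → lab₂ t' ≡ j' → Pending t i' j' →
           ∃[ s ] (t ℕ.≤ s × lab₂ s ≡ j' × InWindow s j' i')
      go {t} ℕ.≤‴-refl e p = t , ℕₚ.≤-refl , e , pending⇒window p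
      go {t} {j' = j'} (ℕ.≤‴-step st≤t') e p with lab₂ t ≟ j'
      ... | yes read = t , ℕₚ.≤-refl , read , pending⇒window p
      ... | no unread =
        let (s , st≤s , rest) = go st≤t' e (inj₁ (pending-persists unread p))
        in s , ℕₚ.<⇒≤ st≤s , rest

    remember-clears : ∀ t i' → mem (suc t) i' (lab₂ t) ≡ false
    remember-clears t i' rewrite mem-step t i' (lab₂ t) | ==-refl (lab₂ t) = refl

    window-origin : ∀ {r t i' j'} → r ℕ.≤ t → mem r i' j' ≡ false → InWindow t j' i' →
                    ∃[ s ] (r ℕ.≤ s × lab₁ s ≡ i')
    window-origin r≤t = go (ℕₚ.≤⇒≤‴ r≤t)
      where
      go : ∀ {r t i' j'} → r ℕ.≤‴ t → mem r i' j' ≡ false → InWindow t j' i' → ∃[ s ] (r ℕ.≤ s × lab₁ s ≡ i')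
      go {r} ℕ.≤‴-refl clear inw rewrite clear = r , ℕₚ.≤-refl , sym (==⇒≡ inw)
      go {r} {i' = i'} {j'} (ℕ.≤‴-step sr≤t) clear inw with i' ≟ lab₁ r
      ... | yes read = r , ℕₚ.≤-refl , sym read
      ... | no unread =
        let (s , sr≤s , e) = go sr≤t (trans (mem-step r i' j') (stays-clear (j' == lab₂ r))) inw
        in s , ℕₚ.<⇒≤ sr≤s , e
        where
        stays-clear : ∀ c → (if c then false else (mem r i' j' ∨ i' == lab₁ r)) ≡ false
        stays-clear true  = refl
        stays-clear false rewrite clear | ≢⇒==false unread = refl

    -- Once all labels read from N on weigh at least a, a recorded label i' of smaller
    -- weight can only stem from before N, so j' has not been read since N.
    stale-entry : ∀ {a N i' j'} → (∀ t → N ℕ.≤ t → a ≤ u t) → wt₁ i' < a →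
                  ∀ t → mem t i' j' ≡ true → ∀ s → N ℕ.≤ s → s ℕ.< t → ¬ lab₂ s ≡ j'
    stale-entry {a} {N} {i'} {j'} above light (suc t) b s N≤s s<1+t
      with if-false-else {j' == lab₂ t} (trans (sym (mem-step t i' j')) b)
    ... | unread , recorded with ∨-true recorded
    ...   | inj₂ e = ⊥-elim (<-irrefl refl (<-≤-trans light
                       (subst (λ x → a ≤ wt₁ x) (sym (==⇒≡ e)) (above t (ℕₚ.≤-trans N≤s (ℕ.s≤s⁻¹ s<1+t))))))
    ...   | inj₁ b' with ℕₚ.m≤n⇒m<n∨m≡n (ℕ.s≤s⁻¹ s<1+t)
    ...     | inj₁ s<t = stale-entry above light t b' s N≤s s<t
    ...     | inj₂ refl = λ e → true≢false (trans (sym (==-refl j')) (subst (λ x → (j' == x) ≡ false) e unread))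

    seen-before : ∀ N j' → Dec (∃[ t ] (N ℕ.≤ t × lab₂ t ≡ j')) →
                  Eventually (λ t → lab₂ t ≡ j' → ∃[ s ] (N ℕ.≤ s × s ℕ.< t × lab₂ s ≡ j'))
    seen-before N j' (yes (t₀ , N≤t₀ , e₀)) = suc t₀ , λ t t₀<t _ → t₀ , N≤t₀ , t₀<t , e₀
    seen-before N j' (no never)             = N , λ t N≤t e → ⊥-elim (never (t , N≤t , e))

    -- If the first weights are eventually at least a, then so (classically) are all
    -- weights in the windows: stale records of lighter labels are eventually cleared.
    window-eventually-above : ∀ {a} → Eventually (λ t → a ≤ u t) →
      DoubleNegation (Eventually (λ t → ∀ i' → InWindow t (lab₂ t) i' → a ≤ wt₁ i'))
    window-eventually-above {a} (N , above) = do
      read? ← ¬¬-decide-Fin m₂ (λ j' → ∃[ t ] (N ℕ.≤ t × lab₂ t ≡ j'))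
      let (N' , seen) = eventually-all m₂ (λ j' → seen-before N j' (read? j'))
      pure (N ℕ.⊔ N' , λ t le → window-above (ℕₚ.m⊔n≤o⇒m≤o N N' le)
                                             (seen t (ℕₚ.m⊔n≤o⇒n≤o N N' le) (lab₂ t) refl))
      where
      window-above : ∀ {t} → N ℕ.≤ t → ∃[ s ] (N ℕ.≤ s × s ℕ.< t × lab₂ s ≡ lab₂ t) →
                     ∀ i' → InWindow t (lab₂ t) i' → a ≤ wt₁ i'
      window-above {t} N≤t earlier i' inw with ∨-true inw
      ... | inj₂ e = subst (λ x → a ≤ wt₁ x) (sym (==⇒≡ e)) (above t N≤t)
      ... | inj₁ b with a ≤? wt₁ i'
      ...   | yes a≤ = a≤
      ...   | no  a≰ = let (s , N≤s , s<t , e) = earlier in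
                       ⊥-elim (stale-entry above (≰⇒> a≰) t b s N≤s s<t e)

    liminf-combined : ∀ {y₁ y₂} → ExactLimInf u y₁ → ExactLimInf v y₂ → DoubleNegation (ExactLimInf z (y₁ + y₂))
    liminf-combined {y₁} {y₂} (eventually₁ , often₁) ((N₂ , above₂) , often₂) = do
      (N' , window-above) ← window-eventually-above eventually₁
      let in-window-self t = pending⇒window {t} {lab₁ t} {lab₂ t} (inj₂ refl)
      pure ((N' ℕ.⊔ N₂ , λ t le →
              +-mono-≤ (minOver-glb m₁ _ wt₁ _ y₁
                         (window-above t (ℕₚ.m⊔n≤o⇒m≤o N' N₂ le) (lab₁ t) (in-window-self t))
                         (window-above t (ℕₚ.m⊔n≤o⇒m≤o N' N₂ le)))
                       (above₂ t (ℕₚ.m⊔n≤o⇒n≤o N' N₂ le))) ,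
            often)
      where
      often : InfinitelyOften (λ t → z t ≤ y₁ + y₂)
      often N₀ =
        let (t₁ , N₀≤t₁ , u≤) = often₁ N₀
            (t₂ , t₁≤t₂ , v≤) = often₂ t₁
            (s , t₁≤s , same , inw) = pending-seen t₁≤t₂ refl (inj₂ refl)
        in s , ℕₚ.≤-trans N₀≤t₁ t₁≤s ,
           ≤-trans (combined-≤ (mem s) (lab₁ s) (lab₂ s) (lab₁ t₁) (subst (λ j → InWindow s j (lab₁ t₁)) (sym same) inw))
                   (+-mono-≤ u≤ (subst (λ j → wt₂ j ≤ y₂) (sym same) v≤))

    -- Upper half, for fixed (classical) decisions of which labels vanish.  The candidate
    -- liminfs are the minimal weights α of the recurring labels of either sequence.
    module UpperHalf {y} (exact-z : ExactLimInf z y)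
                     (vanishes₁? : ∀ i → Dec (Vanishes lab₁ i)) (vanishes₂? : ∀ j → Dec (Vanishes lab₂ j)) where
      module R₁ = RecurrentMinimum wt₁ lab₁ vanishes₁?
      module R₂ = RecurrentMinimum wt₂ lab₂ vanishes₂?

      -- Reading the two minimal recurring labels in turn after z has settled shows y ≤ α₁ + α₂.
      y≤α₁+α₂ : DoubleNegation (y ≤ R₁.α + R₂.α)
      y≤α₁+α₂ = do
        let ((N , above) , _) = exact-z
            (i* , recurring₁ , α₁≡) = R₁.α-attained
            (j* , recurring₂ , α₂≡) = R₂.α-attained
        (t₁ , N≤t₁ , read₁) ← R₁.recurring-often i* recurring₁ N
        (t₂ , t₁≤t₂ , read₂) ← R₂.recurring-often j* recurring₂ t₁
        let (s , t₁≤s , js , inw) = pending-seen t₁≤t₂ read₂ (inj₂ read₁)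
        pure (≤-trans (above s (ℕₚ.≤-trans N≤t₁ t₁≤s))
               (≤-trans (combined-≤ (mem s) (lab₁ s) (lab₂ s) i* (subst (λ j → InWindow s j i*) (sym js) inw))
                        (≤-reflexive (cong₂ _+_ (sym α₁≡) (trans (cong wt₂ js) (sym α₂≡))))))

      module Attained (N' : ℕ) (window-above : ∀ t → N' ℕ.≤ t → ∀ i' → InWindow t (lab₂ t) i' → R₁.α ≤ wt₁ i')
                      (y≤ : y ≤ R₁.α + R₂.α) where
        K : ℕ
        K = N' ℕ.⊔ R₂.bound

        low-split : ∀ t → K ℕ.≤ t → z t ≤ y → ∃[ i' ] (InWindow t (lab₂ t) i' × wt₁ i' ≤ R₁.α × v t ≤ R₂.α)
        low-split t K≤t z≤y =
          let (i' , inw , z≡) = combined-attained (mem t) (lab₁ t) (lab₂ t)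
          in i' , inw , +-≤-split (window-above t (ℕₚ.m⊔n≤o⇒m≤o N' R₂.bound K≤t) i' inw)
                                  (R₂.α-below t (ℕₚ.m⊔n≤o⇒n≤o N' R₂.bound K≤t))
                                  (≤-trans (≤-reflexive (sym z≡)) (≤-trans z≤y y≤))

        exact-v : ExactLimInf v R₂.α
        exact-v = (R₂.bound , R₂.α-below) , λ N →
          let (t , N⊔K≤t , z≤y)   = proj₂ exact-z (N ℕ.⊔ K)
              (_ , _ , _ , v≤α₂) = low-split t (ℕₚ.m⊔n≤o⇒n≤o N K N⊔K≤t) z≤y
          in t , ℕₚ.m⊔n≤o⇒m≤o N K N⊔K≤t , v≤α₂

        -- Among the late low values of z two share the pair (minimal window label, second
        -- label); the column was cleared in between, so that window label was read again.
        u-often : ∀ N → ∃[ s ] (N ℕ.≤ s × u s ≤ R₁.α)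
        u-often N =
          let (k , l , k<l , same)  = repetition (m₁ ℕ.* m₂) pair
              (i≡ , j≡)             = Finₚ.combine-injective (minimiser k) (lab₂ (witness k))
                                                             (minimiser l) (lab₂ (witness l)) same
              (_ , inwₗ , _ , _)    = split l
              (_ , _ , light , _)   = split k
              inw                   = subst₂ (λ j i → InWindow (witness l) j i) (sym j≡) (sym i≡) inwₗ
              (s , r≤s , read)      = window-origin (witness-increasing k<l)
                                                    (remember-clears (witness k) (minimiser k)) inw
          in s , ℕₚ.≤-trans (late k) (ℕₚ.<⇒≤ r≤s) , subst (λ i → wt₁ i ≤ R₁.α) (sym read) light
          where
          open Witnesses (proj₂ exact-z) (N ℕ.⊔ K)
          late : ∀ k → N ℕ.≤ witness k
          late k = ℕₚ.m⊔n≤o⇒m≤o N K (witness-late k)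
          split : ∀ k → ∃[ i' ] (InWindow (witness k) (lab₂ (witness k)) i' × wt₁ i' ≤ R₁.α × v (witness k) ≤ R₂.α)
          split k = low-split (witness k) (ℕₚ.m⊔n≤o⇒n≤o N K (witness-late k)) (witness-holds k)
          minimiser : ℕ → Fin m₁
          minimiser k = proj₁ (split k)
          pair : ℕ → Fin (m₁ ℕ.* m₂)
          pair k = combine (minimiser k) (lab₂ (witness k))

        exact-u : ExactLimInf u R₁.α
        exact-u = (R₁.bound , R₁.α-below) , u-often

    liminf-split : ∀ {y} → ExactLimInf z y →
      DoubleNegation (∃[ α₁ ] ∃[ α₂ ] (ExactLimInf u α₁ × ExactLimInf v α₂ × y ≤ α₁ + α₂))
    liminf-split exact-z = do
      vanishes₁? ← ¬¬-decide-Fin m₁ (Vanishes lab₁)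
      vanishes₂? ← ¬¬-decide-Fin m₂ (Vanishes lab₂)
      let open UpperHalf exact-z vanishes₁? vanishes₂?
      y≤ ← y≤α₁+α₂
      (N' , window-above) ← window-eventually-above (R₁.bound , R₁.α-below)
      let open Attained N' window-above y≤
      pure (R₁.α , R₂.α , exact-u , exact-v , y≤)

length-concatMap : ∀ {A B : Set} (f : A → List B) xs → length (concatMap f xs) ≡ sum (map (λ x → length (f x)) xs)
length-concatMap f []       = refl
length-concatMap f (x ∷ xs) = trans (length-++ (f x)) (cong (length (f x) ℕ.+_) (length-concatMap f xs))

module Transitions {k} (A : WA k) where
  Triple : Set
  Triple = Fin (n A) × Fin k × Fin (n A)

  _≟ₜ_ : DecidableEquality Triple
  _≟ₜ_ = ≡-dec Finₚ._≟_ (≡-dec Finₚ._≟_ Finₚ._≟_)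

  _∈?_ : ∀ t xs → Dec (t ∈ xs)
  t ∈? xs = any? (t ≟ₜ_) xs

  singleton-if : Bool → Triple → List Triple
  singleton-if b t = if b then t ∷ [] else []

  singleton-if-transition : Fin (n A) → Fin k → Fin (n A) → List Triple
  singleton-if-transition q σ q' = singleton-if (δ A q σ q') (q , σ , q')

  list : List Triple
  list = concatMap (λ q → concatMap (λ σ → concatMap (λ q' → singleton-if-transition q σ q')
                                                        (allFin (n A))) (allFin k)) (allFin (n A))

  length-list : length list ≡ transitions A
  length-list =
    trans (length-concatMap _ (allFin (n A))) (cong sum (map-cong (λ q →
    trans (length-concatMap _ (allFin k))     (cong sum (map-cong (λ σ →
    trans (length-concatMap _ (allFin (n A))) (cong sum (map-cong (λ q' → length-singleton q σ q')
      (allFin (n A))))) (allFin k)))) (allFin (n A))))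
    where
    length-singleton : ∀ q σ q' → length (singleton-if-transition q σ q') ≡ (if δ A q σ q' then 1 else 0)
    length-singleton q σ q' with δ A q σ q'
    ... | true  = refl
    ... | false = refl

  ∈-singleton : ∀ q σ q' → δ A q σ q' ≡ true → (q , σ , q') ∈ singleton-if-transition q σ q'
  ∈-singleton q σ q' e rewrite e = here refl

  ∈-list : ∀ q σ q' → δ A q σ q' ≡ true → (q , σ , q') ∈ list
  ∈-list q σ q' e =
    ∈-concatMap⁺ _ (lose (∈-allFin q) (∈-concatMap⁺ _ (lose (∈-allFin σ)
      (∈-concatMap⁺ _ (lose (∈-allFin q') (∈-singleton q σ q' e))))))

  m : ℕ
  m = length list

  weight : Fin m → ℚ
  weight i = let (q , σ , q') = lookup list i in γ A q σ q'

  label : Triple → Maybe (Fin m)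
  label t with t ∈? list
  ... | yes t∈ = just (index t∈)
  ... | no  _  = nothing

  label-weight : ∀ q σ q' i → label (q , σ , q') ≡ just i → weight i ≡ γ A q σ q'
  label-weight q σ q' i e with (q , σ , q') ∈? list
  label-weight q σ q' i refl | yes t∈ rewrite sym (lookup-index t∈) = refl

  label-defined : ∀ q σ q' → δ A q σ q' ≡ true → ∃[ i ] (label (q , σ , q') ≡ just i)
  label-defined q σ q' e with (q , σ , q') ∈? list
  ... | yes t∈ = index t∈ , refl
  ... | no  t∉ = ⊥-elim (t∉ (∈-list q σ q' e))

funToFin-cong : ∀ {a b} (f g : Fin a → Fin b) → (∀ i → f i ≡ g i) → funToFin f ≡ funToFin g
funToFin-cong {zero}  f g f≗g = refl
funToFin-cong {suc a} f g f≗g = cong₂ combine (f≗g zero) (funToFin-cong (f ∘ suc) (g ∘ suc) (f≗g ∘ suc))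

module Encoding (n₁ n₂ m₁ m₂ : ℕ) where
  open Inverse Finₚ.2↔Bool using (to; from; strictlyInverseˡ)

  Bits : Set
  Bits = Fin m₁ → Fin m₂ → Bool

  Code : Set
  Code = Fin (n₁ ℕ.* n₂ ℕ.* 2 ℕ.^ (m₁ ℕ.* m₂))

  bitFunction : Bits → Fin (m₁ ℕ.* m₂) → Fin 2
  bitFunction B x = let (i , j) = remQuot {m₁} m₂ x in from (B i j)

  encode : Fin n₁ → Fin n₂ → Bits → Code
  encode q₁ q₂ B = combine (combine q₁ q₂) (funToFin (bitFunction B))

  private
    split : Code → Fin (n₁ ℕ.* n₂) × Fin (2 ℕ.^ (m₁ ℕ.* m₂))
    split = remQuot {n₁ ℕ.* n₂} (2 ℕ.^ (m₁ ℕ.* m₂))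

    split-encode : ∀ q₁ q₂ B → split (encode q₁ q₂ B) ≡ (combine q₁ q₂ , funToFin (bitFunction B))
    split-encode q₁ q₂ B = Finₚ.remQuot-combine (combine q₁ q₂) (funToFin (bitFunction B))

  components : Code → Fin n₁ × Fin n₂
  components c = remQuot {n₁} n₂ (proj₁ (split c))

  state₁ : Code → Fin n₁
  state₁ c = proj₁ (components c)

  state₂ : Code → Fin n₂
  state₂ c = proj₂ (components c)

  bits : Code → Bits
  bits c i j = to (finToFun (proj₂ (split c)) (combine i j))

  components-encode : ∀ q₁ q₂ B → components (encode q₁ q₂ B) ≡ (q₁ , q₂)
  components-encode q₁ q₂ B = begin
    remQuot n₂ (proj₁ (split (encode q₁ q₂ B)))  ≡⟨ cong (remQuot n₂ ∘ proj₁) (split-encode q₁ q₂ B) ⟩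
    remQuot n₂ (combine q₁ q₂)                   ≡⟨ Finₚ.remQuot-combine q₁ q₂ ⟩
    (q₁ , q₂)                                    ∎
    where open ≡-Reasoning

  state₁-encode : ∀ q₁ q₂ B → state₁ (encode q₁ q₂ B) ≡ q₁
  state₁-encode q₁ q₂ B = cong proj₁ (components-encode q₁ q₂ B)

  state₂-encode : ∀ q₁ q₂ B → state₂ (encode q₁ q₂ B) ≡ q₂
  state₂-encode q₁ q₂ B = cong proj₂ (components-encode q₁ q₂ B)

  bits-encode : ∀ q₁ q₂ B i j → bits (encode q₁ q₂ B) i j ≡ B i j
  bits-encode q₁ q₂ B i j = begin
    to (finToFun (proj₂ (split (encode q₁ q₂ B))) (combine i j))
      ≡⟨ cong (λ p → to (finToFun (proj₂ p) (combine i j))) (split-encode q₁ q₂ B) ⟩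
    to (finToFun (funToFin (bitFunction B)) (combine i j))
      ≡⟨ cong to (Finₚ.finToFun-funToFin (bitFunction B) (combine i j)) ⟩
    to (bitFunction B (combine i j))
      ≡⟨ cong (λ p → to (from (B (proj₁ p) (proj₂ p)))) (Finₚ.remQuot-combine {m₁} i j) ⟩
    to (from (B i j))
      ≡⟨ strictlyInverseˡ (B i j) ⟩
    B i j
      ∎
    where open ≡-Reasoning

  encode-cong : ∀ q₁ q₂ B B' → (∀ i j → B i j ≡ B' i j) → encode q₁ q₂ B ≡ encode q₁ q₂ B'
  encode-cong q₁ q₂ B B' B≗B' =
    cong (combine (combine q₁ q₂)) (funToFin-cong (bitFunction B) (bitFunction B')
      (λ x → cong from (B≗B' (proj₁ (remQuot {m₁} m₂ x)) (proj₂ (remQuot {m₁} m₂ x)))))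

module SumAutomaton {k} (A₁ A₂ : WA k) where
  module T₁ = Transitions A₁
  module T₂ = Transitions A₂
  open WindowMinimum T₁.weight T₂.weight public
  open Encoding (n A₁) (n A₂) T₁.m T₂.m public

  updated : Maybe (Fin T₁.m) → Maybe (Fin T₂.m) → Memory → Code → Bool
  updated (just i) (just j) B s' = s' == encode (state₁ s') (state₂ s') (remember B i j)
  updated _        _        B s' = false

  weight-of : Maybe (Fin T₁.m) → Maybe (Fin T₂.m) → Memory → ℚ
  weight-of (just i) (just j) B = combined B i j
  weight-of _        _        B = 0ℚ

  δ₁₂ : Code → Fin k → Code → Bool
  δ₁₂ s σ s' = δ A₁ (state₁ s) σ (state₁ s') ∧ (δ A₂ (state₂ s) σ (state₂ s') ∧
               updated (T₁.label (state₁ s , σ , state₁ s')) (T₂.label (state₂ s , σ , state₂ s')) (bits s) s')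

  γ₁₂ : Code → Fin k → Code → ℚ
  γ₁₂ s σ s' = weight-of (T₁.label (state₁ s , σ , state₁ s')) (T₂.label (state₂ s , σ , state₂ s')) (bits s)

  record Step (s : Code) (σ : Fin k) (s' : Code) : Set where
    field
      name₁  : Fin T₁.m
      name₂  : Fin T₂.m
      moves₁ : δ A₁ (state₁ s) σ (state₁ s') ≡ true
      moves₂ : δ A₂ (state₂ s) σ (state₂ s') ≡ true
      named₁ : T₁.label (state₁ s , σ , state₁ s') ≡ just name₁
      named₂ : T₂.label (state₂ s , σ , state₂ s') ≡ just name₂
      target : s' ≡ encode (state₁ s') (state₂ s') (remember (bits s) name₁ name₂)

  step-of : ∀ {s σ s'} → δ₁₂ s σ s' ≡ true → Step s σ s'
  step-of {s} {σ} {s'} e with ∧-true {δ A₁ (state₁ s) σ (state₁ s')} e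
  ... | moves₁ , e' with ∧-true {δ A₂ (state₂ s) σ (state₂ s')} e'
  ... | moves₂ , upd with T₁.label (state₁ s , σ , state₁ s') in named₁ | T₂.label (state₂ s , σ , state₂ s') in named₂
  ... | just i | just j = record { name₁ = i ; name₂ = j ; moves₁ = moves₁ ; moves₂ = moves₂
                                 ; named₁ = named₁ ; named₂ = named₂ ; target = ==⇒≡ upd }

  step-weight : ∀ {s σ s'} (st : Step s σ s') → γ₁₂ s σ s' ≡ combined (bits s) (Step.name₁ st) (Step.name₂ st)
  step-weight st rewrite Step.named₁ st | Step.named₂ st = refl

  δ₁₂-intro : ∀ {s q₁ q₂ B} σ q₁' q₂' {i j} →
              state₁ s ≡ q₁ → state₂ s ≡ q₂ → (∀ i' j' → bits s i' j' ≡ B i' j') →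
              δ A₁ q₁ σ q₁' ≡ true → δ A₂ q₂ σ q₂' ≡ true →
              T₁.label (q₁ , σ , q₁') ≡ just i → T₂.label (q₂ , σ , q₂') ≡ just j →
              δ₁₂ s σ (encode q₁' q₂' (remember B i j)) ≡ true
  δ₁₂-intro {s} {B = B} σ q₁' q₂' {i} {j} refl refl bits≗B moves₁ moves₂ named₁ named₂
    rewrite state₁-encode q₁' q₂' (remember B i j) | state₂-encode q₁' q₂' (remember B i j)
          | moves₁ | moves₂ | named₁ | named₂ =
    dec-true (_ ≟ _) (begin
      encode q₁' q₂' (remember B i j)            ≡⟨ encode-cong q₁' q₂' _ _ (remember-cong B (bits s) i j (λ i' j' → sym (bits≗B i' j'))) ⟩
      encode q₁' q₂' (remember (bits s) i j)     ≡⟨ cong₂ (λ a b → encode a b (remember (bits s) i j)) (sym (state₁-encode q₁' q₂' (remember B i j))) (sym (state₂-encode q₁' q₂' (remember B i j))) ⟩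
      encode (state₁ s') (state₂ s') (remember (bits s) i j) ∎)
    where
    open ≡-Reasoning
    s' = encode q₁' q₂' (remember B i j)

  γ₁₂-intro : ∀ {s q₁ q₂ B} σ q₁' q₂' B' {i j} →
              state₁ s ≡ q₁ → state₂ s ≡ q₂ → (∀ i' j' → bits s i' j' ≡ B i' j') →
              T₁.label (q₁ , σ , q₁') ≡ just i → T₂.label (q₂ , σ , q₂') ≡ just j →
              γ₁₂ s σ (encode q₁' q₂' B') ≡ combined B i j
  γ₁₂-intro {s} {B = B} σ q₁' q₂' B' {i} {j} refl refl bits≗B named₁ named₂
    rewrite state₁-encode q₁' q₂' B' | state₂-encode q₁' q₂' B' | named₁ | named₂ =
    combined-cong (bits s) B i j bits≗B

  total₁₂ : ∀ s σ → ∃[ s' ] (δ₁₂ s σ s' ≡ true)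
  total₁₂ s σ =
    let (q₁' , moves₁) = total A₁ (state₁ s) σ
        (q₂' , moves₂) = total A₂ (state₂ s) σ
        (i , named₁)   = T₁.label-defined _ _ _ moves₁
        (j , named₂)   = T₂.label-defined _ _ _ moves₂
    in encode q₁' q₂' (remember (bits s) i j) ,
       δ₁₂-intro σ q₁' q₂' refl refl (λ _ _ → refl) moves₁ moves₂ named₁ named₂

  empty : Memory
  empty _ _ = false

  A₁₂ : WA k
  A₁₂ = record { n = n A₁ ℕ.* n A₂ ℕ.* 2 ℕ.^ (T₁.m ℕ.* T₂.m) ; qI = encode (qI A₁) (qI A₂) empty
               ; δ = δ₁₂ ; γ = γ₁₂ ; total = total₁₂ }

  states-bound : states A₁₂ ℕ.≤ 1 ℕ.* (states A₁ ℕ.* states A₂ ℕ.* 2 ℕ.^ (transitions A₁ ℕ.* transitions A₂))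
  states-bound rewrite T₁.length-list | T₂.length-list = ℕₚ.≤-reflexive (sym (ℕₚ.*-identityˡ _))

  -- The components move deterministically, and the transition names and hence the
  -- memory update are determined by the component moves.
  deterministic : Deterministic A₁ → Deterministic A₂ → Deterministic A₁₂
  deterministic det₁ det₂ s σ s₁ s₂ e₁ e₂ = begin
    s₁                                                              ≡⟨ Step.target st₁ ⟩
    encode (state₁ s₁) (state₂ s₁) (remember (bits s) i₁ j₁)        ≡⟨ cong₂ (λ q₁ q₂ → encode q₁ q₂ (remember (bits s) i₁ j₁)) same₁ same₂ ⟩
    encode (state₁ s₂) (state₂ s₂) (remember (bits s) i₁ j₁)        ≡⟨ cong₂ (λ i j → encode (state₁ s₂) (state₂ s₂) (remember (bits s) i j)) same-name₁ same-name₂ ⟩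
    encode (state₁ s₂) (state₂ s₂) (remember (bits s) i₂ j₂)        ≡⟨ sym (Step.target st₂) ⟩
    s₂                                                              ∎
    where
    open ≡-Reasoning
    st₁ = step-of e₁
    st₂ = step-of e₂
    open Step st₁ using () renaming (name₁ to i₁; name₂ to j₁)
    open Step st₂ using () renaming (name₁ to i₂; name₂ to j₂)
    same₁ = det₁ (state₁ s) σ _ _ (Step.moves₁ st₁) (Step.moves₁ st₂)
    same₂ = det₂ (state₂ s) σ _ _ (Step.moves₂ st₁) (Step.moves₂ st₂)
    same-name₁ : i₁ ≡ i₂
    same-name₁ = just-injective (trans (sym (Step.named₁ st₁))
                   (trans (cong (λ q → T₁.label (state₁ s , σ , q)) same₁) (Step.named₁ st₂)))
    same-name₂ : j₁ ≡ j₂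
    same-name₂ = just-injective (trans (sym (Step.named₂ st₁))
                   (trans (cong (λ q → T₂.label (state₂ s , σ , q)) same₂) (Step.named₂ st₂)))

  module Projection {w : Word k} (r : Run A₁₂ w) where
    step : ∀ t → Step (ρ r t) (w t) (ρ r (suc t))
    step t = step-of (valid r t)

    run₁ : Run A₁ w
    run₁ = record { ρ = state₁ ∘ ρ r ; init = trans (cong state₁ (init r)) (state₁-encode _ _ empty)
                  ; valid = Step.moves₁ ∘ step }

    run₂ : Run A₂ w
    run₂ = record { ρ = state₂ ∘ ρ r ; init = trans (cong state₂ (init r)) (state₂-encode _ _ empty)
                  ; valid = Step.moves₂ ∘ step }

    trace : Trace
    trace = record { lab₁ = Step.name₁ ∘ step ; lab₂ = Step.name₂ ∘ step ; mem = bits ∘ ρ r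
                   ; mem-step = λ t i' j' → trans (cong (λ c → bits c i' j') (Step.target (step t))) (bits-encode _ _ _ i' j') }

    open Along trace using (u; v; z)

    weights≗z : ∀ t → weights r t ≡ z t
    weights≗z t = step-weight (step t)

    u≗weights₁ : ∀ t → u t ≡ weights run₁ t
    u≗weights₁ t = T₁.label-weight _ _ _ _ (Step.named₁ (step t))

    v≗weights₂ : ∀ t → v t ≡ weights run₂ t
    v≗weights₂ t = T₂.label-weight _ _ _ _ (Step.named₂ (step t))

  module Lifting {w : Word k} (r₁ : Run A₁ w) (r₂ : Run A₂ w) where
    named₁ : ∀ t → ∃[ i ] (T₁.label (ρ r₁ t , w t , ρ r₁ (suc t)) ≡ just i)
    named₁ t = T₁.label-defined _ _ _ (valid r₁ t)

    named₂ : ∀ t → ∃[ j ] (T₂.label (ρ r₂ t , w t , ρ r₂ (suc t)) ≡ just j)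
    named₂ t = T₂.label-defined _ _ _ (valid r₂ t)

    memory : ℕ → Memory
    memory zero    = empty
    memory (suc t) = remember (memory t) (proj₁ (named₁ t)) (proj₁ (named₂ t))

    code : ℕ → Code
    code t = encode (ρ r₁ t) (ρ r₂ t) (memory t)

    code-state₁ : ∀ t → state₁ (code t) ≡ ρ r₁ t
    code-state₁ t = state₁-encode (ρ r₁ t) (ρ r₂ t) (memory t)

    code-state₂ : ∀ t → state₂ (code t) ≡ ρ r₂ t
    code-state₂ t = state₂-encode (ρ r₁ t) (ρ r₂ t) (memory t)

    code-bits : ∀ t i' j' → bits (code t) i' j' ≡ memory t i' j'
    code-bits t = bits-encode (ρ r₁ t) (ρ r₂ t) (memory t)

    run : Run A₁₂ w
    run = record
      { ρ     = code
      ; init  = cong₂ (λ q₁ q₂ → encode q₁ q₂ empty) (init r₁) (init r₂)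
      ; valid = λ t → δ₁₂-intro (w t) _ _ (code-state₁ t) (code-state₂ t) (code-bits t)
                                (valid r₁ t) (valid r₂ t) (proj₂ (named₁ t)) (proj₂ (named₂ t)) }

    trace : Trace
    trace = record { lab₁ = proj₁ ∘ named₁ ; lab₂ = proj₁ ∘ named₂ ; mem = memory ; mem-step = λ _ _ _ → refl }

    open Along trace using (u; v; z)

    z≗weights : ∀ t → z t ≡ weights run t
    z≗weights t = sym (γ₁₂-intro (w t) _ _ (memory (suc t)) (code-state₁ t) (code-state₂ t) (code-bits t)
                                 (proj₂ (named₁ t)) (proj₂ (named₂ t)))

    weights₁≗u : ∀ t → weights r₁ t ≡ u t
    weights₁≗u t = sym (T₁.label-weight _ _ _ _ (proj₂ (named₁ t)))

    weights₂≗v : ∀ t → weights r₂ t ≡ v t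
    weights₂≗v t = sym (T₂.label-weight _ _ _ _ (proj₂ (named₂ t)))

  sum-correct : IsSumOf A₁₂ A₁ A₂
  sum-correct w x₁ x₂ sup₁ sup₂ = upper , least
    where
    upper : ∀ y → Σ (Run A₁₂ w) (λ r → IsLimInf (weights r) y) → y ≤ x₁ + x₂
    upper y (r , L) = decidable-stable (y ≤? x₁ + x₂) (do
        (α₁ , α₂ , exact₁ , exact₂ , y≤) ← liminf-split (exact-cong weights≗z (run-exact r L))
        pure (≤-trans y≤ (+-mono-≤ (proj₁ sup₁ α₁ (run₁ , exact⇒liminf (exact-cong u≗weights₁ exact₁)))
                                   (proj₁ sup₂ α₂ (run₂ , exact⇒liminf (exact-cong v≗weights₂ exact₂))))))
      where
      open Projection r
      open Along trace

    least : ∀ b → (∀ y → Σ (Run A₁₂ w) (λ r → IsLimInf (weights r) y) → y ≤ b) → x₁ + x₂ ≤ b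
    least b bounded = sup-sum sup₁ sup₂ λ where
      y₁ y₂ (r₁ , L₁) (r₂ , L₂) → decidable-stable (y₁ + y₂ ≤? b) (do
        let open Lifting r₁ r₂
            open Along trace
        exact ← liminf-combined {y₁} {y₂} (exact-cong weights₁≗u (run-exact r₁ L₁)) (exact-cong weights₂≗v (run-exact r₂ L₂))
        pure (bounded (y₁ + y₂) (run , exact⇒liminf (exact-cong z≗weights exact))))

theorem4p20 : ClosedUnderSumCost Deterministic × ClosedUnderSumCost AnyWA
theorem4p20 =
  (1 , λ A₁ A₂ det₁ det₂ → let open SumAutomaton A₁ A₂ in
         A₁₂ , deterministic det₁ det₂ , sum-correct , states-bound) ,
  (1 , λ A₁ A₂ _ _ → let open SumAutomaton A₁ A₂ in
         A₁₂ , tt , sum-correct , states-bound)
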